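{- Let $\Sigma$ be a finite set of formulas, $\Gamma$ a set of formulas and $A$ a formula. If $\Sigma;\Gamma\vdash_\omega A$, then $\Sigma;\Gamma\vdash A$.
   Context: Formulas are built from propositional variables $p_0,p_1,\dots$ and $\bot$ by $\to$, $\Box$, $\Box^+$ ($\neg A:=A\to\bot$, $A\wedge B:=\neg(A\to\neg B)$, $A\vee B:=\neg A\to B$). The logic $\mathsf{K}^+$ has axioms: classical tautologies; $\Box(A\to B)\to(\Box A\to\Box B)$; $\Box^+(A\to B)\to(\Box^+A\to\Box^+B)$; $\Box^+A\to\Box A\wedge\Box\Box^+A$; $\Box A\wedge\Box^+(A\to\Box A)\to\Box^+A$; rules ($\mathsf{mp}$) from $A$, $A\to B$ infer $B$ and ($\mathsf{nec}$) from $A$ infer $\Box^+A$. The rule ($\omega$) has countably many premises $B_0\to\Box(C\wedge B_1)$, $B_1\to\Box(C\wedge B_2)$, … and conclusion $B_0\to\Box^+C$; all premises except the leftmost are boxed. An $\omega$-derivation is a well-founded (possibly infinite) tree of formulas built by ($\mathsf{mp}$), ($\mathsf{nec}$), ($\omega$). An assumption leaf is a leaf not marked by an axiom of $\mathsf{K}^+$; it is boxed if the path from the root to it passes through an application of ($\mathsf{nec}$) or through a boxed premise of an application of ($\omega$). $\Sigma;\Gamma\vdash_\omega A$ means there is an $\omega$-derivation with root $A$ whose boxed assumption leaves are marked by formulas of $\Sigma$ and non-boxed assumption leaves by formulas of $\Gamma$. $\Sigma;\Gamma\vdash A$ means the same, with an $\omega$-derivation containing no application of ($\omega$). -}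

module Defs where

open import Data.Nat using (ℕ; zero; suc)
open import Data.Bool using (Bool; true; false; if_then_else_)
open import Data.List using (List)
open import Data.List.Membership.Propositional using (_∈_)
open import Relation.Binary.PropositionalEquality using (_≡_)

infixr 5 _⇒_

data Fm : Set where
  var  : ℕ → Fm
  ⊥'   : Fm
  _⇒_  : Fm → Fm → Fm
  □    : Fm → Fm
  □⁺   : Fm → Fm

¬' : Fm → Fm
¬' A = A ⇒ ⊥'

_∧'_ : Fm → Fm → Fm
A ∧' B = ¬' (A ⇒ ¬' B)

_∨'_ : Fm → Fm → Fm
A ∨' B = ¬' A ⇒ B

eval : (Fm → Bool) → Fm → Bool
eval v (var n) = v (var n)
eval v ⊥' = false
eval v (A ⇒ B) = if eval v A then eval v B else true
eval v (□ A) = v (□ A)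
eval v (□⁺ A) = v (□⁺ A)

Tautology : Fm → Set
Tautology A = (v : Fm → Bool) → eval v A ≡ true

data Axiom : Fm → Set where
  taut   : ∀ {A} → Tautology A → Axiom A
  kBox   : ∀ A B → Axiom (□ (A ⇒ B) ⇒ (□ A ⇒ □ B))
  kBox⁺  : ∀ A B → Axiom (□⁺ (A ⇒ B) ⇒ (□⁺ A ⇒ □⁺ B))
  unfold : ∀ A → Axiom (□⁺ A ⇒ (□ A ∧' □ (□⁺ A)))
  ind    : ∀ A → Axiom ((□ A ∧' □⁺ (A ⇒ □ A)) ⇒ □⁺ A)

-- Der w Σ Γ A : there is a derivation tree with root A whose
-- boxed assumption leaves are in Σ and non-boxed assumption leaves in Γ.  Passing through (nec) or through a boxed
-- premise of (ω) makes all leaves above boxed, which is modelled by replacing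
-- the non-boxed assumption set Γ with Σ in those premises.
data Der (w : Bool) (Σ : Fm → Set) : (Fm → Set) → Fm → Set₁ where
  ax    : ∀ {Γ A} → Axiom A → Der w Σ Γ A
  hyp   : ∀ {Γ A} → Γ A → Der w Σ Γ A
  mp    : ∀ {Γ A B} → Der w Σ Γ A → Der w Σ Γ (A ⇒ B) → Der w Σ Γ B
  nec   : ∀ {Γ A} → Der w Σ Σ A → Der w Σ Γ (□⁺ A)
  omega : ∀ {Γ} → w ≡ true → (C : Fm) (B : ℕ → Fm)
        → Der w Σ Γ (B 0 ⇒ □ (C ∧' B 1))
        → ((n : ℕ) → Der w Σ Σ (B (suc n) ⇒ □ (C ∧' B (suc (suc n)))))
        → Der w Σ Γ (B 0 ⇒ □⁺ C)

_⨾_⊢ω_ : List Fm → (Fm → Set) → Fm → Set₁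
Σ ⨾ Γ ⊢ω A = Der true (λ B → B ∈ Σ) Γ A

_⨾_⊢_ : List Fm → (Fm → Set) → Fm → Set₁
Σ ⨾ Γ ⊢ A = Der false (λ B → B ∈ Σ) Γ A

-- The rule (ω) is admissible in the ω-free calculus, so its applications can be removed
-- bottom-up. Given ω-free derivations of the premises, it suffices to prove the K⁺-theorem
--   φ = □⁺⋀Σ → (B₀ → □(C ∧ B₁)) → (B₀ → □⁺C),
-- because □⁺⋀Σ follows by (nec) from the boxed assumptions; this is where finiteness of Σ is
-- used. φ is proved through a finite model. Start from all truth assignments to the prime
-- formulas of the Fischer–Ladner closure of φ and repeatedly discard a defective one (Pratt's
-- elimination of Hintikka sets): its characteristic formula is refutable, so the disjunction of
-- the characteristic formulas of the survivors remains a theorem. The survivors form a Kripke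
-- model in which □⁺ is the transitive closure of □ and every formula of the closure holds
-- exactly where the assignment says. φ holds in it: where □⁺⋀Σ holds, Σ holds at every
-- reachable world, so there the ω-premises hold by soundness, and induction along reachability
-- gives □⁺C.

module Submission where

open import Defs
open import Function using (_∘_)
open import Data.Nat using (ℕ; zero; suc; _+_; _<_; _≤_; z≤n; s≤s)
open import Data.Nat.Properties as ℕ
  using ( ≤-refl; ≤-trans; <-≤-trans; ≤-reflexive; ≤-<-trans; <⇒≱; m<1+n⇒m≤n; m≤n+m
        ; +-suc; +-identityʳ; +-mono-≤; +-mono-<-≤; +-mono-≤-<; +-monoˡ-<)
open import Data.Bool using (Bool; true; false; if_then_else_)
open import Data.Bool.Properties using (¬-not) renaming (_≟_ to _≟ᵇ_)
open import Data.List using (List; []; _∷_; _++_; length; filter; map)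
open import Data.List.Membership.Propositional using (_∈_)
open import Data.List.Membership.Propositional.Properties
  using (∈-++⁺ˡ; ∈-++⁺ʳ; ∈-++⁻; ∈-filter⁺; ∈-map⁺; ∈-map⁻)
open import Data.List.Relation.Binary.Subset.Propositional using (_⊆_)
open import Data.List.Relation.Unary.Any using (here; there)
open import Data.Vec using (Vec; []; _∷_)
open import Data.Vec.Properties using (≡-dec)
open import Data.Product using (∃; _×_; _,_; proj₁; proj₂)
open import Data.Sum using (_⊎_; inj₁; inj₂; [_,_]′)
open import Data.Empty using (⊥-elim)
open import Data.Unit using (⊤; tt)
open import Relation.Nullary using (yes; no)
open import Relation.Unary using (Decidable)
open import Relation.Nullary.Decidable using (map′; _×-dec_)
open import Relation.Binary.Definitions using (DecidableEquality)
open import Relation.Binary.PropositionalEquality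

private variable
  k : ℕ

  A B C D H : Fm
  w : Bool
  Σ Γ : Fm → Set

-- Boolean semantics of the connectives

infixr 6 _⇒ᵇ_
infixr 7 _∨ᵇ_
infixr 8 _∧ᵇ_

_⇒ᵇ_ : Bool → Bool → Bool
a ⇒ᵇ b = if a then b else true

¬ᵇ_ : Bool → Bool
¬ᵇ a = a ⇒ᵇ false

_∧ᵇ_ : Bool → Bool → Bool
a ∧ᵇ b = ¬ᵇ (a ⇒ᵇ ¬ᵇ b)

_∨ᵇ_ : Bool → Bool → Bool
a ∨ᵇ b = ¬ᵇ a ⇒ᵇ b

true≢false : true ≢ false
true≢false ()

⇒ᵇ-intro : ∀ {a b} → (a ≡ true → b ≡ true) → a ⇒ᵇ b ≡ true
⇒ᵇ-intro {true}  f = f refl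
⇒ᵇ-intro {false} _ = refl

⇒ᵇ-elim : ∀ {a b} → a ⇒ᵇ b ≡ true → a ≡ true → b ≡ true
⇒ᵇ-elim h refl = h

false-or-true : ∀ a → a ≡ false ⊎ a ≡ true
false-or-true false = inj₁ refl
false-or-true true  = inj₂ refl

⇒ᵇ-or-counterexample : ∀ a b → (a ≡ true → b ≡ true) ⊎ (a ≡ true × b ≡ false)
⇒ᵇ-or-counterexample false _     = inj₁ λ ()
⇒ᵇ-or-counterexample true  true  = inj₁ λ _ → refl
⇒ᵇ-or-counterexample true  false = inj₂ (refl , refl)

¬ᵇ-intro : ∀ {a} → a ≡ false → ¬ᵇ a ≡ true
¬ᵇ-intro refl = refl

¬ᵇ-elim : ∀ {a} → ¬ᵇ a ≡ true → a ≡ false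
¬ᵇ-elim {false} _ = refl

∧ᵇ-intro : ∀ {a b} → a ≡ true → b ≡ true → a ∧ᵇ b ≡ true
∧ᵇ-intro refl refl = refl

∧ᵇ-elimˡ : ∀ {a b} → a ∧ᵇ b ≡ true → a ≡ true
∧ᵇ-elimˡ {true} _ = refl

∧ᵇ-elimʳ : ∀ {a b} → a ∧ᵇ b ≡ true → b ≡ true
∧ᵇ-elimʳ {true} {true} _ = refl

∨ᵇ-introˡ : ∀ {a b} → a ≡ true → a ∨ᵇ b ≡ true
∨ᵇ-introˡ refl = refl

∨ᵇ-introʳ : ∀ {a b} → b ≡ true → a ∨ᵇ b ≡ true
∨ᵇ-introʳ {true}  _ = refl
∨ᵇ-introʳ {false} h = h

∨ᵇ-elim : ∀ {a b} → a ∨ᵇ b ≡ true → a ≡ true ⊎ b ≡ true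
∨ᵇ-elim {true}  _ = inj₁ refl
∨ᵇ-elim {false} h = inj₂ h

-- The formulas are explicit: Agda cannot recover them from the unfolded Boolean expressions.
module _ (v : Fm → Bool) (A B : Fm) where

  ⇒-intro : (eval v A ≡ true → eval v B ≡ true) → eval v (A ⇒ B) ≡ true
  ⇒-intro = ⇒ᵇ-intro {eval v A} {eval v B}

  ⇒-elim : eval v (A ⇒ B) ≡ true → eval v A ≡ true → eval v B ≡ true
  ⇒-elim = ⇒ᵇ-elim {eval v A} {eval v B}

  ∧-intro : eval v A ≡ true → eval v B ≡ true → eval v (A ∧' B) ≡ true
  ∧-intro = ∧ᵇ-intro {eval v A} {eval v B}

  ∧-elimˡ : eval v (A ∧' B) ≡ true → eval v A ≡ true
  ∧-elimˡ = ∧ᵇ-elimˡ {eval v A} {eval v B}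

  ∧-elimʳ : eval v (A ∧' B) ≡ true → eval v B ≡ true
  ∧-elimʳ = ∧ᵇ-elimʳ {eval v A} {eval v B}

  ∨-introˡ : eval v A ≡ true → eval v (A ∨' B) ≡ true
  ∨-introˡ = ∨ᵇ-introˡ {eval v A} {eval v B}

  ∨-introʳ : eval v B ≡ true → eval v (A ∨' B) ≡ true
  ∨-introʳ = ∨ᵇ-introʳ {eval v A} {eval v B}

  ∨-elim : eval v (A ∨' B) ≡ true → eval v A ≡ true ⊎ eval v B ≡ true
  ∨-elim = ∨ᵇ-elim {eval v A} {eval v B}

¬-intro : ∀ v A → eval v A ≡ false → eval v (¬' A) ≡ true
¬-intro v A = ¬ᵇ-intro {eval v A}

¬-elim : ∀ v A → eval v (¬' A) ≡ true → eval v A ≡ false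
¬-elim v A = ¬ᵇ-elim {eval v A}

⊤' : Fm
⊤' = ¬' ⊥'

⋀ : List Fm → Fm
⋀ []       = ⊤'
⋀ (A ∷ As) = A ∧' ⋀ As

⋀-elim : ∀ v {A} As → eval v (⋀ As) ≡ true → A ∈ As → eval v A ≡ true
⋀-elim v (B ∷ As) h (here refl) = ∧-elimˡ v B (⋀ As) h
⋀-elim v (B ∷ As) h (there m)   = ⋀-elim v As (∧-elimʳ v B (⋀ As) h) m

⋀-map-cong : ∀ {v v'} (f : Fm → Fm) (L : List Fm)
           → (∀ {x} → x ∈ L → eval v (f x) ≡ eval v' (f x))
           → eval v (⋀ (map f L)) ≡ eval v' (⋀ (map f L))
⋀-map-cong f []      _  = refl
⋀-map-cong f (x ∷ L) eq =
  cong₂ _∧ᵇ_ (eq (here refl)) (⋀-map-cong f L (eq ∘ there))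

var-injective : ∀ {m n} → var m ≡ var n → m ≡ n
var-injective refl = refl

⇒-injective : ∀ {A B C D} → A ⇒ B ≡ C ⇒ D → A ≡ C × B ≡ D
⇒-injective refl = refl , refl

□-injective : □ A ≡ □ B → A ≡ B
□-injective refl = refl

□⁺-injective : □⁺ A ≡ □⁺ B → A ≡ B
□⁺-injective refl = refl

infix 4 _≟_
_≟_ : DecidableEquality Fm
var m   ≟ var n   = map′ (cong var) var-injective (m ℕ.≟ n)
⊥'      ≟ ⊥'      = yes refl
(A ⇒ B) ≟ (C ⇒ D) = map′ (λ (p , q) → cong₂ _⇒_ p q) ⇒-injective (A ≟ C ×-dec B ≟ D)
□ A     ≟ □ B     = map′ (cong □) □-injective (A ≟ B)
□⁺ A    ≟ □⁺ B    = map′ (cong □⁺) □⁺-injective (A ≟ B)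
var _   ≟ ⊥'      = no λ ()
var _   ≟ _ ⇒ _   = no λ ()
var _   ≟ □ _     = no λ ()
var _   ≟ □⁺ _    = no λ ()
⊥'      ≟ var _   = no λ ()
⊥'      ≟ _ ⇒ _   = no λ ()
⊥'      ≟ □ _     = no λ ()
⊥'      ≟ □⁺ _    = no λ ()
_ ⇒ _   ≟ var _   = no λ ()
_ ⇒ _   ≟ ⊥'      = no λ ()
_ ⇒ _   ≟ □ _     = no λ ()
_ ⇒ _   ≟ □⁺ _    = no λ ()
□ _     ≟ var _   = no λ ()
□ _     ≟ ⊥'      = no λ ()
□ _     ≟ _ ⇒ _   = no λ ()
□ _     ≟ □⁺ _    = no λ ()
□⁺ _    ≟ var _   = no λ ()
□⁺ _    ≟ ⊥'      = no λ ()
□⁺ _    ≟ _ ⇒ _   = no λ ()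
□⁺ _    ≟ □ _     = no λ ()

-- Derived rules of K⁺

Thm : Fm → Set₁
Thm A = ∀ {Σ Γ} → Der false Σ Γ A

byTaut : (∀ v → eval v A ≡ true) → Der w Σ Γ A
byTaut t = ax (taut t)

byTaut₁ : (∀ v → eval v A ≡ true → eval v B ≡ true) → Der w Σ Γ A → Der w Σ Γ B
byTaut₁ {A} {B} t d = mp d (byTaut λ v → ⇒-intro v A B (t v))

byTaut₂ : (∀ v → eval v A ≡ true → eval v B ≡ true → eval v C ≡ true)
        → Der w Σ Γ A → Der w Σ Γ B → Der w Σ Γ C
byTaut₂ {A} {B} {C} t d e =
  mp e (mp d (byTaut λ v → ⇒-intro v A (B ⇒ C) λ a → ⇒-intro v B C (t v a)))

byTaut₃ : (∀ v → eval v A ≡ true → eval v B ≡ true → eval v C ≡ true → eval v D ≡ true)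
        → Der w Σ Γ A → Der w Σ Γ B → Der w Σ Γ C → Der w Σ Γ D
byTaut₃ {A} {B} {C} {D} t d e f =
  mp f (mp e (mp d (byTaut λ v →
    ⇒-intro v A (B ⇒ C ⇒ D) λ a → ⇒-intro v B (C ⇒ D) λ b → ⇒-intro v C D (t v a b))))

⇒-trans : Der w Σ Γ (A ⇒ B) → Der w Σ Γ (B ⇒ C) → Der w Σ Γ (A ⇒ C)
⇒-trans {A = A} {B} {C} = byTaut₂ λ v f g → ⇒-intro v A C (⇒-elim v B C g ∘ ⇒-elim v A B f)

⋀-hyp : (As : List Fm) → (∀ {A} → A ∈ As → Γ A) → Der w Σ Γ (⋀ As)
⋀-hyp []       _ = byTaut λ _ → refl
⋀-hyp (A ∷ As) h = byTaut₂ (λ v → ∧-intro v A (⋀ As)) (hyp (h (here refl))) (⋀-hyp As (h ∘ there))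

□⁺⇒□ : Thm (□⁺ A ⇒ □ A)
□⁺⇒□ {A} = byTaut₁ first (ax (unfold A))
  where
  first : ∀ v → eval v (□⁺ A ⇒ □ A ∧' □ (□⁺ A)) ≡ true → eval v (□⁺ A ⇒ □ A) ≡ true
  first v u = ⇒-intro v (□⁺ A) (□ A) (∧-elimˡ v (□ A) (□ (□⁺ A)) ∘ ⇒-elim v (□⁺ A) (□ A ∧' □ (□⁺ A)) u)

□⁺⇒□□⁺ : Thm (□⁺ A ⇒ □ (□⁺ A))
□⁺⇒□□⁺ {A} = byTaut₁ second (ax (unfold A))
  where
  second : ∀ v → eval v (□⁺ A ⇒ □ A ∧' □ (□⁺ A)) ≡ true → eval v (□⁺ A ⇒ □ (□⁺ A)) ≡ true
  second v u = ⇒-intro v (□⁺ A) (□ (□⁺ A)) (∧-elimʳ v (□ A) (□ (□⁺ A)) ∘ ⇒-elim v (□⁺ A) (□ A ∧' □ (□⁺ A)) u)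

□-nec : Thm A → Thm (□ A)
□-nec d = mp (nec d) □⁺⇒□

□-mono : Thm (A ⇒ B) → Thm (□ A ⇒ □ B)
□-mono d = mp (□-nec d) (ax (kBox _ _))

□⁺-mono : Thm (A ⇒ B) → Thm (□⁺ A ⇒ □⁺ B)
□⁺-mono d = mp (nec d) (ax (kBox⁺ _ _))

□-⊤ : Thm (H ⇒ □ ⊤')
□-⊤ {H} = byTaut₁ (λ v b → ⇒-intro v H (□ ⊤') λ _ → b) (□-nec (byTaut λ _ → refl))

□-∧ : Thm (H ⇒ □ A) → Thm (H ⇒ □ B) → Thm (H ⇒ □ (A ∧' B))
□-∧ {H} {A} {B} f g = byTaut₃ combine
    (⇒-trans f (□-mono (byTaut λ v → ⇒-intro v A (B ⇒ A ∧' B) λ a → ⇒-intro v B (A ∧' B) (∧-intro v A B a))))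
    g (ax (kBox B (A ∧' B)))
  where
  combine : ∀ v → eval v (H ⇒ □ (B ⇒ A ∧' B)) ≡ true → eval v (H ⇒ □ B) ≡ true
          → eval v (□ (B ⇒ A ∧' B) ⇒ □ B ⇒ □ (A ∧' B)) ≡ true → eval v (H ⇒ □ (A ∧' B)) ≡ true
  combine v f g k = ⇒-intro v H (□ (A ∧' B)) λ h →
    ⇒-elim v (□ B) (□ (A ∧' B))
      (⇒-elim v (□ (B ⇒ A ∧' B)) (□ B ⇒ □ (A ∧' B)) k (⇒-elim v H (□ (B ⇒ A ∧' B)) f h))
      (⇒-elim v H (□ B) g h)

□-⋀ : (As : List Fm) → (∀ {A} → A ∈ As → Thm (H ⇒ □ A)) → Thm (H ⇒ □ (⋀ As))
□-⋀ []       _ = □-⊤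
□-⋀ (A ∷ As) h = □-∧ (h (here refl)) (□-⋀ As (h ∘ there))

□⁺-induction : Thm (H ⇒ □ A) → Thm (A ⇒ □ A) → Thm (H ⇒ □⁺ A)
□⁺-induction {H} {A} first step = byTaut₃ combine first (nec step) (ax (ind A))
  where
  combine : ∀ v → eval v (H ⇒ □ A) ≡ true → eval v (□⁺ (A ⇒ □ A)) ≡ true
          → eval v (□ A ∧' □⁺ (A ⇒ □ A) ⇒ □⁺ A) ≡ true → eval v (H ⇒ □⁺ A) ≡ true
  combine v f s i = ⇒-intro v H (□⁺ A) λ h →
    ⇒-elim v (□ A ∧' □⁺ (A ⇒ □ A)) (□⁺ A) i (∧-intro v (□ A) (□⁺ (A ⇒ □ A)) (⇒-elim v H (□ A) f h) s)

-- Finite sets of worlds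

-- The recursions over all 2ᵏ worlds are kept opaque, so that type checking never unfolds
-- them when k is concrete.

World : ℕ → Set
World = Vec Bool

infix 4 _⊆ʷ_
_⊆ʷ_ : (World k → Bool) → (World k → Bool) → Set
S ⊆ʷ T = ∀ {x} → S x ≡ true → T x ≡ true

infixl 9 _↾_
_↾_ : {A : Set} → (World (suc k) → A) → Bool → World k → A
(S ↾ b) x = S (b ∷ x)

opaque
  every : (World k → Bool) → Bool
  every {zero}  S = S []
  every {suc k} S = every (S ↾ true) ∧ᵇ every (S ↾ false)

  every-intro : (S : World k → Bool) → (∀ x → S x ≡ true) → every S ≡ true
  every-intro {zero}  S h = h []
  every-intro {suc k} S h =
    ∧ᵇ-intro (every-intro (S ↾ true) (h ∘ (true ∷_))) (every-intro (S ↾ false) (h ∘ (false ∷_)))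

  every-elim : (S : World k → Bool) → every S ≡ true → ∀ x → S x ≡ true
  every-elim {zero}  S h []          = h
  every-elim {suc k} S h (true ∷ x)  = every-elim (S ↾ true) (∧ᵇ-elimˡ h) x
  every-elim {suc k} S h (false ∷ x) = every-elim (S ↾ false) (∧ᵇ-elimʳ {every (S ↾ true)} h) x

opaque
  search : {P Q : World k → Set} → (∀ x → P x ⊎ Q x) → (∀ x → P x) ⊎ ∃ Q
  search {zero} d with d []
  ... | inj₁ p = inj₁ λ { [] → p }
  ... | inj₂ q = inj₂ ([] , q)
  search {suc k} d with search (d ∘ (true ∷_)) | search (d ∘ (false ∷_))
  ... | inj₂ (x , q) | _             = inj₂ (true ∷ x , q)
  ... | inj₁ _       | inj₂ (x , q)  = inj₂ (false ∷ x , q)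
  ... | inj₁ p       | inj₁ p'       = inj₁ λ { (true ∷ x) → p x ; (false ∷ x) → p' x }

∈-search : {X : Set} {P : X → Set} {Q : Set} (xs : List X)
         → (∀ {x} → x ∈ xs → P x ⊎ Q) → (∀ {x} → x ∈ xs → P x) ⊎ Q
∈-search []       _ = inj₁ λ ()
∈-search (x ∷ xs) d with d (here refl) | ∈-search xs (d ∘ there)
... | inj₂ q | _      = inj₂ q
... | inj₁ _ | inj₂ q = inj₂ q
... | inj₁ p | inj₁ ps = inj₁ λ { (here refl) → p ; (there m) → ps m }

some : (World k → Bool) → Bool
some S = ¬ᵇ every (¬ᵇ_ ∘ S)

some-intro : (S : World k → Bool) {x : World k} → S x ≡ true → some S ≡ true
some-intro S {x} h =
  ¬ᵇ-intro (¬-not λ none → true≢false (trans (sym h) (¬ᵇ-elim (every-elim (¬ᵇ_ ∘ S) none x))))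

some-elim : (S : World k → Bool) → some S ≡ true → ∃ λ x → S x ≡ true
some-elim S h with search (λ x → false-or-true (S x))
... | inj₂ witness = witness
... | inj₁ none    =
  ⊥-elim (true≢false (trans (sym (every-intro (¬ᵇ_ ∘ S) (¬ᵇ-intro ∘ none))) (¬ᵇ-elim h)))

opaque
  count : (World k → Bool) → ℕ
  count {zero}  S = if S [] then 1 else 0
  count {suc k} S = count (S ↾ true) + count (S ↾ false)

  count-mono : (S T : World k → Bool) → S ⊆ʷ T → count S ≤ count T
  count-mono {zero} S T S⊆T with S [] in e
  ... | true  rewrite S⊆T e = ≤-refl
  ... | false = z≤n
  count-mono {suc k} S T S⊆T =
    +-mono-≤ (count-mono (S ↾ true) (T ↾ true) S⊆T) (count-mono (S ↾ false) (T ↾ false) S⊆T)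

  count-< : (S T : World k → Bool) {x : World k}
          → S ⊆ʷ T → T x ≡ true → S x ≡ false → count S < count T
  count-< {zero} S T {[]} _ Tx Sx rewrite Tx | Sx = s≤s z≤n
  count-< {suc k} S T {true ∷ x} S⊆T Tx Sx =
    +-mono-<-≤ (count-< (S ↾ true) (T ↾ true) S⊆T Tx Sx) (count-mono (S ↾ false) (T ↾ false) S⊆T)
  count-< {suc k} S T {false ∷ x} S⊆T Tx Sx =
    +-mono-≤-< (count-mono (S ↾ true) (T ↾ true) S⊆T) (count-< (S ↾ false) (T ↾ false) S⊆T Tx Sx)

everything : World k → Bool
everything _ = true

#World : ℕ → ℕ
#World k = count {k} everything

count-≤ : (S : World k → Bool) → count S ≤ #World k
count-≤ S = count-mono S everything λ _ → refl

infixl 6 _─_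
_─_ : (World k → Bool) → World k → World k → Bool
(S ─ x) y with ≡-dec _≟ᵇ_ y x
... | yes _ = false
... | no  _ = S y

─-⊆ : (S : World k → Bool) {x : World k} → (S ─ x) ⊆ʷ S
─-⊆ S {x} {y} h with ≡-dec _≟ᵇ_ y x
... | no _ = h

─-removes : (S : World k → Bool) (x : World k) → (S ─ x) x ≡ false
─-removes S x with ≡-dec _≟ᵇ_ x x
... | yes _  = refl
... | no x≢x = ⊥-elim (x≢x refl)

─-keeps : (S : World k → Bool) {x y : World k} → y ≢ x → S y ≡ true → (S ─ x) y ≡ true
─-keeps S {x} {y} y≢x h with ≡-dec _≟ᵇ_ y x
... | yes y≡x = ⊥-elim (y≢x y≡x)
... | no  _   = h

count-─ : (S : World k → Bool) {x : World k} → S x ≡ true → count (S ─ x) < count S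
count-─ S {x} Sx = count-< (S ─ x) S (─-⊆ S) Sx (─-removes S x)

opaque
  ⋁ : (World k → Bool) → (World k → Fm) → Fm
  ⋁ {zero}  S F = if S [] then F [] else ⊥'
  ⋁ {suc k} S F = ⋁ (S ↾ true) (F ↾ true) ∨' ⋁ (S ↾ false) (F ↾ false)

  ⋁-intro : ∀ v (S : World k → Bool) F {x} → S x ≡ true → eval v (F x) ≡ true → eval v (⋁ S F) ≡ true
  ⋁-intro {zero}  v S F {[]} Sx Fx rewrite Sx = Fx
  ⋁-intro {suc k} v S F {true ∷ x} Sx Fx =
    ∨-introˡ v (⋁ (S ↾ true) (F ↾ true)) (⋁ (S ↾ false) (F ↾ false))
      (⋁-intro v (S ↾ true) (F ↾ true) Sx Fx)
  ⋁-intro {suc k} v S F {false ∷ x} Sx Fx =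
    ∨-introʳ v (⋁ (S ↾ true) (F ↾ true)) (⋁ (S ↾ false) (F ↾ false))
      (⋁-intro v (S ↾ false) (F ↾ false) Sx Fx)

  ⋁-elim : ∀ v (S : World k → Bool) F → eval v (⋁ S F) ≡ true → ∃ λ x → S x ≡ true × eval v (F x) ≡ true
  ⋁-elim {zero} v S F h with S [] in e
  ... | true = [] , e , h
  ⋁-elim {suc k} v S F h
    with ∨-elim v (⋁ (S ↾ true) (F ↾ true)) (⋁ (S ↾ false) (F ↾ false)) h
  ... | inj₁ h₁ = let x , Sx , Fx = ⋁-elim v (S ↾ true) (F ↾ true) h₁ in true ∷ x , Sx , Fx
  ... | inj₂ h₂ = let x , Sx , Fx = ⋁-elim v (S ↾ false) (F ↾ false) h₂ in false ∷ x , Sx , Fx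

  ⋁-⇒ : (S : World k → Bool) (F : World k → Fm) → (∀ {x} → S x ≡ true → Thm (F x ⇒ D)) → Thm (⋁ S F ⇒ D)
  ⋁-⇒ {zero} S F h with S [] in e
  ... | true  = h e
  ... | false = byTaut λ _ → refl
  ⋁-⇒ {suc k} {D} S F h =
    byTaut₂ cases (⋁-⇒ (S ↾ true) (F ↾ true) h) (⋁-⇒ (S ↾ false) (F ↾ false) h)
    where
    X Y : Fm
    X = ⋁ (S ↾ true) (F ↾ true)
    Y = ⋁ (S ↾ false) (F ↾ false)
    cases : ∀ v → eval v (X ⇒ D) ≡ true → eval v (Y ⇒ D) ≡ true → eval v (X ∨' Y ⇒ D) ≡ true
    cases v f g = ⇒-intro v (X ∨' Y) D λ h → [ ⇒-elim v X D f , ⇒-elim v Y D g ]′ (∨-elim v X Y h)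

⋁-─ : (S : World k → Bool) (F : World k → Fm) {x : World k}
    → Thm (⋁ S F) → Thm (¬' (F x)) → Thm (⋁ (S ─ x) F)
⋁-─ S F {x} cover ¬Fx = byTaut₂ removed cover ¬Fx
  where
  removed : ∀ v → eval v (⋁ S F) ≡ true → eval v (¬' (F x)) ≡ true → eval v (⋁ (S ─ x) F) ≡ true
  removed v c n =
    let y , Sy , Fy = ⋁-elim v S F c in
    ⋁-intro v (S ─ x) F (─-keeps S (λ { refl → true≢false (trans (sym Fy) (¬-elim v (F x) n)) }) Sy) Fy

-- Reachability in a finite graph

module Reachability {k : ℕ} (R : World k → World k → Bool) where

  private variable
    x y z : World k

  step : (World k → Bool) → World k → Bool
  step S y = S y ∨ᵇ some (λ x → S x ∧ᵇ R x y)

  step-⊇ : (S : World k → Bool) → S ⊆ʷ step S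
  step-⊇ S = ∨ᵇ-introˡ

  Closed : (World k → Bool) → Set
  Closed S = ∀ {x y} → S x ≡ true → R x y ≡ true → S y ≡ true

  step-stable⇒closed : (S : World k → Bool) → step S ⊆ʷ S → Closed S
  step-stable⇒closed S stable {x} {y} Sx Rxy =
    stable (∨ᵇ-introʳ {S y} (some-intro (λ x → S x ∧ᵇ R x y) {x} (∧ᵇ-intro Sx Rxy)))

  closure : ℕ → (World k → Bool) → World k → Bool
  closure zero    S = S
  closure (suc n) S with search (λ y → ⇒ᵇ-or-counterexample (step S y) (S y))
  ... | inj₁ _ = S
  ... | inj₂ _ = closure n (step S)

  closure-⊇ : ∀ n S → S ⊆ʷ closure n S
  closure-⊇ zero    S h = h
  closure-⊇ (suc n) S h with search (λ y → ⇒ᵇ-or-counterexample (step S y) (S y))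
  ... | inj₁ _ = h
  ... | inj₂ _ = closure-⊇ n (step S) (step-⊇ S h)

  closure-ind : ∀ n S (P : World k → Set)
              → (∀ {y} → S y ≡ true → P y)
              → (∀ {x y} → closure n S x ≡ true → P x → R x y ≡ true → P y)
              → ∀ {y} → closure n S y ≡ true → P y
  closure-ind zero    S P base _    = base
  closure-ind (suc n) S P base next with search (λ y → ⇒ᵇ-or-counterexample (step S y) (S y))
  ... | inj₁ _ = base
  ... | inj₂ _ = closure-ind n (step S) P base′ next
    where
    base′ : ∀ {y} → step S y ≡ true → P y
    base′ {y} h with ∨ᵇ-elim {S y} h
    ... | inj₁ Sy = base Sy
    ... | inj₂ pred with some-elim (λ x → S x ∧ᵇ R x y) pred
    ...   | x , SRxy = next (closure-⊇ n (step S) (step-⊇ S (∧ᵇ-elimˡ SRxy))) (base (∧ᵇ-elimˡ SRxy))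
                            (∧ᵇ-elimʳ {S x} SRxy)

  -- Every step that leaves S unclosed adds a world, which cannot happen more than #World k times.
  closure-closed : ∀ n S → #World k < count S + n → Closed (closure n S)
  closure-closed zero    S bound =
    ⊥-elim (<⇒≱ bound (≤-trans (≤-reflexive (+-identityʳ (count S))) (count-≤ S)))
  closure-closed (suc n) S bound with search (λ y → ⇒ᵇ-or-counterexample (step S y) (S y))
  ... | inj₁ stable = step-stable⇒closed S (stable _)
  ... | inj₂ (y , grows , new) = closure-closed n (step S) bound′
    where
    bound′ : #World k < count (step S) + n
    bound′ = ≤-<-trans (m<1+n⇒m≤n (subst (#World k <_) (+-suc (count S) n) bound))
                       (+-monoˡ-< n (count-< S (step S) (step-⊇ S) grows new))

  reach : World k → World k → Bool
  reach x = closure (suc (#World k)) (R x)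

  reach-base : R x y ≡ true → reach x y ≡ true
  reach-base {x} = closure-⊇ _ (R x)

  reach-step : reach x y ≡ true → R y z ≡ true → reach x z ≡ true
  reach-step {x} = closure-closed _ (R x) (m≤n+m _ (count (R x)))

  reach-ind : (P : World k → Set)
            → (∀ {y} → R x y ≡ true → P y)
            → (∀ {y z} → reach x y ≡ true → P y → R y z ≡ true → P z)
            → reach x y ≡ true → P y
  reach-ind {x} P base next = closure-ind _ (R x) P base next

  reach-trans : reach x y ≡ true → reach y z ≡ true → reach x z ≡ true
  reach-trans {x} rxy = reach-ind (λ z → reach x z ≡ true) (reach-step rxy) (λ _ → reach-step)

-- Finite Kripke models

module Kripke {k : ℕ} (R : World k → World k → Bool) (V : World k → ℕ → Bool) where

  open Reachability R public

  private variable
    x y : World k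

  sat : World k → Fm → Bool
  sat x (var n)  = V x n
  sat x ⊥'       = false
  sat x (A ⇒ B)  = sat x A ⇒ᵇ sat x B
  sat x (□ A)    = every λ y → R x y ⇒ᵇ sat y A
  sat x (□⁺ A)   = every λ y → reach x y ⇒ᵇ sat y A

  sat-eval : ∀ x A → eval (sat x) A ≡ sat x A
  sat-eval x (var n)  = refl
  sat-eval x ⊥'       = refl
  sat-eval x (A ⇒ B)  = cong₂ _⇒ᵇ_ (sat-eval x A) (sat-eval x B)
  sat-eval x (□ A)    = refl
  sat-eval x (□⁺ A)   = refl

  module _ (x : World k) (A B : Fm) where

    sat-⇒-intro : (sat x A ≡ true → sat x B ≡ true) → sat x (A ⇒ B) ≡ true
    sat-⇒-intro = ⇒ᵇ-intro {sat x A} {sat x B}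

    sat-⇒-elim : sat x (A ⇒ B) ≡ true → sat x A ≡ true → sat x B ≡ true
    sat-⇒-elim = ⇒ᵇ-elim {sat x A} {sat x B}

    sat-∧-intro : sat x A ≡ true → sat x B ≡ true → sat x (A ∧' B) ≡ true
    sat-∧-intro = ∧ᵇ-intro {sat x A} {sat x B}

    sat-∧-elimˡ : sat x (A ∧' B) ≡ true → sat x A ≡ true
    sat-∧-elimˡ = ∧ᵇ-elimˡ {sat x A} {sat x B}

    sat-∧-elimʳ : sat x (A ∧' B) ≡ true → sat x B ≡ true
    sat-∧-elimʳ = ∧ᵇ-elimʳ {sat x A} {sat x B}

  □-intro : ∀ A → (∀ {y} → R x y ≡ true → sat y A ≡ true) → sat x (□ A) ≡ true
  □-intro {x} A h = every-intro (λ y → R x y ⇒ᵇ sat y A) λ y → ⇒ᵇ-intro {R x y} h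

  □-elim : ∀ A → sat x (□ A) ≡ true → R x y ≡ true → sat y A ≡ true
  □-elim {x} {y} A h = ⇒ᵇ-elim {R x y} (every-elim (λ y → R x y ⇒ᵇ sat y A) h y)

  □-counter : ∀ A → R x y ≡ true → sat y A ≡ false → sat x (□ A) ≡ false
  □-counter A r ¬A = ¬-not λ h → true≢false (trans (sym (□-elim A h r)) ¬A)

  □⁺-intro : ∀ A → (∀ {y} → reach x y ≡ true → sat y A ≡ true) → sat x (□⁺ A) ≡ true
  □⁺-intro {x} A h = every-intro (λ y → reach x y ⇒ᵇ sat y A) λ y → ⇒ᵇ-intro {reach x y} h

  □⁺-elim : ∀ A → sat x (□⁺ A) ≡ true → reach x y ≡ true → sat y A ≡ true
  □⁺-elim {x} {y} A h = ⇒ᵇ-elim {reach x y} (every-elim (λ y → reach x y ⇒ᵇ sat y A) h y)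

  □⁺-counter : ∀ A → reach x y ≡ true → sat y A ≡ false → sat x (□⁺ A) ≡ false
  □⁺-counter A r ¬A = ¬-not λ h → true≢false (trans (sym (□⁺-elim A h r)) ¬A)

  axiom-valid : Axiom A → ∀ x → sat x A ≡ true
  axiom-valid {A} (taut t) x = trans (sym (sat-eval x A)) (t (sat x))
  axiom-valid (kBox A B) x =
    sat-⇒-intro x (□ (A ⇒ B)) (□ A ⇒ □ B) λ f → sat-⇒-intro x (□ A) (□ B) λ a →
      □-intro B λ r → sat-⇒-elim _ A B (□-elim (A ⇒ B) f r) (□-elim A a r)
  axiom-valid (kBox⁺ A B) x =
    sat-⇒-intro x (□⁺ (A ⇒ B)) (□⁺ A ⇒ □⁺ B) λ f → sat-⇒-intro x (□⁺ A) (□⁺ B) λ a →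
      □⁺-intro B λ r → sat-⇒-elim _ A B (□⁺-elim (A ⇒ B) f r) (□⁺-elim A a r)
  axiom-valid (unfold A) x =
    sat-⇒-intro x (□⁺ A) (□ A ∧' □ (□⁺ A)) λ h → sat-∧-intro x (□ A) (□ (□⁺ A))
      (□-intro A λ r → □⁺-elim A h (reach-base r))
      (□-intro (□⁺ A) λ r → □⁺-intro A λ r′ → □⁺-elim A h (reach-trans (reach-base r) r′))
  axiom-valid (ind A) x =
    sat-⇒-intro x (□ A ∧' □⁺ (A ⇒ □ A)) (□⁺ A) λ h →
      let now   = sat-∧-elimˡ x (□ A) (□⁺ (A ⇒ □ A)) h
          later = sat-∧-elimʳ x (□ A) (□⁺ (A ⇒ □ A)) h in
      □⁺-intro A (reach-ind (λ y → sat y A ≡ true) (□-elim A now)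
        λ {y} rxy Ay → □-elim A (sat-⇒-elim y A (□ A) (□⁺-elim (A ⇒ □ A) later rxy) Ay))

  ω-sound : (C : Fm) (B : ℕ → Fm)
          → sat x (B 0 ⇒ □ (C ∧' B 1)) ≡ true
          → (∀ n {y} → reach x y ≡ true → sat y (B (suc n) ⇒ □ (C ∧' B (suc (suc n)))) ≡ true)
          → sat x (B 0 ⇒ □⁺ C) ≡ true
  ω-sound {x} C B first next =
    sat-⇒-intro x (B 0) (□⁺ C) λ b₀ → □⁺-intro C λ r → proj₁ (proj₂ (along b₀ r))
    where
    Invariant : World k → Set
    Invariant y = ∃ λ n → sat y C ≡ true × sat y (B (suc n)) ≡ true

    enter : ∀ n {y z} → sat y (□ (C ∧' B (suc n))) ≡ true → R y z ≡ true → Invariant z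
    enter n {z = z} h r =
      let c = □-elim (C ∧' B (suc n)) h r in
      n , sat-∧-elimˡ z C (B (suc n)) c , sat-∧-elimʳ z C (B (suc n)) c

    along : sat x (B 0) ≡ true → reach x y ≡ true → Invariant y
    along b₀ = reach-ind Invariant (enter 0 (sat-⇒-elim x (B 0) (□ (C ∧' B 1)) first b₀))
      λ {y} rxy (n , _ , bₙ) →
        enter (suc n) (sat-⇒-elim y (B (suc n)) (□ (C ∧' B (suc (suc n)))) (next n rxy) bₙ)

  sound : ∀ {w Σ Γ} → Der w Σ Γ A
        → (Z : World k → Set)
        → (∀ {y z} → Z y → R y z ≡ true → Z z)
        → (∀ {y} → Z y → ∀ {B} → Σ B → sat y B ≡ true)
        → (∀ {y} → R x y ≡ true → Z y)
        → (∀ {B} → Γ B → sat x B ≡ true)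
        → sat x A ≡ true
  sound {x = x} (ax a) _ _ _ _ _ = axiom-valid a x
  sound (hyp h) _ _ _ _ Γ-holds = Γ-holds h
  sound {x = x} (mp {A = A} {B} d e) Z closed Σ-holds succ Γ-holds =
    sat-⇒-elim x A B (sound e Z closed Σ-holds succ Γ-holds) (sound d Z closed Σ-holds succ Γ-holds)
  sound (nec {A = A} d) Z closed Σ-holds succ _ = □⁺-intro A λ r →
    let inZ = reach-ind Z succ (λ _ → closed) r in
    sound d Z closed Σ-holds (closed inZ) (Σ-holds inZ)
  sound (omega _ C B d ds) Z closed Σ-holds succ Γ-holds =
    ω-sound C B (sound d Z closed Σ-holds succ Γ-holds) λ n r →
      let inZ = reach-ind Z succ (λ _ → closed) r in
      sound (ds n) Z closed Σ-holds (closed inZ) (Σ-holds inZ)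

-- Fischer–Ladner closure and characteristic formulas

FL : Fm → List Fm
FL (var n)  = var n ∷ []
FL ⊥'       = ⊥' ∷ []
FL (A ⇒ B)  = (A ⇒ B) ∷ FL A ++ FL B
FL (□ A)    = □ A ∷ FL A
FL (□⁺ A)   = □⁺ A ∷ □ A ∷ □ (□⁺ A) ∷ FL A

Unfolding : List Fm → Fm → Set
Unfolding L (A ⇒ B) = A ∈ L × B ∈ L
Unfolding L (□ A)   = A ∈ L
Unfolding L (□⁺ A)  = A ∈ L × □ A ∈ L × □ (□⁺ A) ∈ L
Unfolding L _       = ⊤

Unfolding-mono : ∀ {L L′} → L ⊆ L′ → ∀ χ → Unfolding L χ → Unfolding L′ χ
Unfolding-mono L⊆L′ (var n)  _           = tt
Unfolding-mono L⊆L′ ⊥'       _           = tt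
Unfolding-mono L⊆L′ (A ⇒ B)  (a , b)     = L⊆L′ a , L⊆L′ b
Unfolding-mono L⊆L′ (□ A)    a           = L⊆L′ a
Unfolding-mono L⊆L′ (□⁺ A)   (a , b , c) = L⊆L′ a , L⊆L′ b , L⊆L′ c

FL-self : ∀ φ → φ ∈ FL φ
FL-self (var n)  = here refl
FL-self ⊥'       = here refl
FL-self (A ⇒ B)  = here refl
FL-self (□ A)    = here refl
FL-self (□⁺ A)   = here refl

FL-closed : ∀ φ {χ} → χ ∈ FL φ → Unfolding (FL φ) χ
FL-closed (var n) (here refl) = tt
FL-closed ⊥'      (here refl) = tt
FL-closed (A ⇒ B) (here refl) = there (∈-++⁺ˡ (FL-self A)) , there (∈-++⁺ʳ (FL A) (FL-self B))
FL-closed (A ⇒ B) {χ} (there m) with ∈-++⁻ (FL A) m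
... | inj₁ a = Unfolding-mono (there ∘ ∈-++⁺ˡ) χ (FL-closed A a)
... | inj₂ b = Unfolding-mono (there ∘ ∈-++⁺ʳ (FL A)) χ (FL-closed B b)
FL-closed (□ A) (here refl)     = there (FL-self A)
FL-closed (□ A) {χ} (there m)   = Unfolding-mono there χ (FL-closed A m)
FL-closed (□⁺ A) (here refl)                 =
  there (there (there (FL-self A))) , there (here refl) , there (there (here refl))
FL-closed (□⁺ A) (there (here refl))         = there (there (there (FL-self A)))
FL-closed (□⁺ A) (there (there (here refl))) = here refl
FL-closed (□⁺ A) {χ} (there (there (there m))) =
  Unfolding-mono (there ∘ there ∘ there) χ (FL-closed A m)

data Prime : Fm → Set where
  var-prime : ∀ n → Prime (var n)
  □-prime   : ∀ A → Prime (□ A)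
  □⁺-prime  : ∀ A → Prime (□⁺ A)

prime? : Decidable Prime
prime? (var n)  = yes (var-prime n)
prime? ⊥'       = no λ ()
prime? (A ⇒ B)  = no λ ()
prime? (□ A)    = yes (□-prime A)
prime? (□⁺ A)   = yes (□⁺-prime A)

valuation : (P : List Fm) → World (length P) → Fm → Bool
valuation []      []      _ = false
valuation (p ∷ P) (b ∷ x) ψ with p ≟ ψ
... | yes _ = b
... | no  _ = valuation P x ψ

literal : Fm → Bool → Fm
literal p true  = p
literal p false = ¬' p

characteristic : (P : List Fm) → World (length P) → Fm
characteristic []      []      = ⊤'
characteristic (p ∷ P) (b ∷ x) = literal p b ∧' characteristic P x

truthValues : (Fm → Bool) → (P : List Fm) → World (length P)
truthValues v []      = []
truthValues v (p ∷ P) = eval v p ∷ truthValues v P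

literal-sound : ∀ v p b → eval v (literal p b) ≡ true → eval v p ≡ b
literal-sound v p true  h = h
literal-sound v p false h = ¬-elim v p h

literal-truthValue : ∀ v p → eval v (literal p (eval v p)) ≡ true
literal-truthValue v p with eval v p in e
... | true  = e
... | false = ¬-intro v p e

characteristic-valuation : ∀ v P x → eval v (characteristic P x) ≡ true
                         → ∀ {p} → p ∈ P → eval v p ≡ valuation P x p
characteristic-valuation v (q ∷ P) (b ∷ x) h {p} m with q ≟ p
... | yes refl = literal-sound v q b (∧-elimˡ v (literal q b) (characteristic P x) h)
... | no  q≢p  =
  characteristic-valuation v P x (∧-elimʳ v (literal q b) (characteristic P x) h) (tail m)
  where
  tail : p ∈ q ∷ P → p ∈ P
  tail (here p≡q) = ⊥-elim (q≢p (sym p≡q))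
  tail (there m)  = m

characteristic-truthValues : ∀ v P → eval v (characteristic P (truthValues v P)) ≡ true
characteristic-truthValues v []      = refl
characteristic-truthValues v (p ∷ P) =
  ∧-intro v (literal p (eval v p)) (characteristic P (truthValues v P))
    (literal-truthValue v p) (characteristic-truthValues v P)

-- The finite model of a formula

module Filtration (φ : Fm) where

  L : List Fm
  L = FL φ

  P : List Fm
  P = filter prime? L

  W : Set
  W = World (length P)

  V : W → Fm → Bool
  V = valuation P

  ⌜_⌝ : W → Fm
  ⌜_⌝ = characteristic P

  ⋁⌜_⌝ : (W → Bool) → Fm
  ⋁⌜ G ⌝ = ⋁ G ⌜_⌝

  agree : ∀ v x → eval v ⌜ x ⌝ ≡ true → ∀ {χ} → χ ∈ L → eval v χ ≡ eval (V x) χ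
  agree v x h {var n} m = characteristic-valuation v P x h (∈-filter⁺ prime? m (var-prime n))
  agree v x h {⊥'}    m = refl
  agree v x h {A ⇒ B} m = let a , b = FL-closed φ m in cong₂ _⇒ᵇ_ (agree v x h a) (agree v x h b)
  agree v x h {□ A}   m = characteristic-valuation v P x h (∈-filter⁺ prime? m (□-prime A))
  agree v x h {□⁺ A}  m = characteristic-valuation v P x h (∈-filter⁺ prime? m (□⁺-prime A))

  ⌜⌝⇒ : ∀ x {χ} → χ ∈ L → eval (V x) χ ≡ true → Thm (⌜ x ⌝ ⇒ χ)
  ⌜⌝⇒ x {χ} m e = byTaut λ v → ⇒-intro v ⌜ x ⌝ χ λ h → trans (agree v x h m) e

  refute : ∀ x {χ} → Thm (⌜ x ⌝ ⇒ χ) → χ ∈ L → eval (V x) χ ≡ false → Thm (¬' ⌜ x ⌝)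
  refute x {χ} d m e = byTaut₁ contradict d
    where
    contradict : ∀ v → eval v (⌜ x ⌝ ⇒ χ) ≡ true → eval v (¬' ⌜ x ⌝) ≡ true
    contradict v t = ¬-intro v ⌜ x ⌝ (¬-not λ h →
      true≢false (trans (sym (⇒-elim v ⌜ x ⌝ χ t h)) (trans (agree v x h m) e)))

  ⋁⌜everything⌝ : Thm ⋁⌜ everything ⌝
  ⋁⌜everything⌝ = byTaut λ v →
    ⋁-intro v everything ⌜_⌝ {truthValues v P} refl (characteristic-truthValues v P)

  ⋁⇒ : ∀ Y {χ} → χ ∈ L → (∀ {y} → Y y ≡ true → eval (V y) χ ≡ true) → Thm (⋁⌜ Y ⌝ ⇒ χ)
  ⋁⇒ Y m holds = ⋁-⇒ Y ⌜_⌝ λ {y} Yy → ⌜⌝⇒ y m (holds Yy)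

  necessity : W → Fm → Fm
  necessity x (□ A) = if V x (□ A) then A else ⊤'
  necessity x _     = ⊤'

  unboxed : W → Fm
  unboxed x = ⋀ (map (necessity x) L)

  ⌜⌝⇒□unboxed : ∀ x → Thm (⌜ x ⌝ ⇒ □ (unboxed x))
  ⌜⌝⇒□unboxed x = □-⋀ (map (necessity x) L) λ m →
    let χ , χ∈L , eq = ∈-map⁻ (necessity x) m in
    subst (λ B → Thm (⌜ x ⌝ ⇒ □ B)) (sym eq) (necessary χ χ∈L)
    where
    necessary : ∀ χ → χ ∈ L → Thm (⌜ x ⌝ ⇒ □ (necessity x χ))
    necessary (□ A) m with V x (□ A) in e
    ... | true  = ⌜⌝⇒ x m e
    ... | false = □-⊤
    necessary (var _)  _ = □-⊤
    necessary ⊥'       _ = □-⊤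
    necessary (_ ⇒ _)  _ = □-⊤
    necessary (□⁺ _)   _ = □-⊤

  unboxed-elim : ∀ u x {A} → eval u (unboxed x) ≡ true → □ A ∈ L → V x (□ A) ≡ true → eval u A ≡ true
  unboxed-elim u x {A} h m e =
    subst (λ b → eval u (if b then A else ⊤') ≡ true) e
      (⋀-elim u (map (necessity x) L) h (∈-map⁺ (necessity x) m))

  unboxed-agree : ∀ v x y → eval v ⌜ y ⌝ ≡ true → eval v (unboxed x) ≡ eval (V y) (unboxed x)
  unboxed-agree v x y h = ⋀-map-cong (necessity x) L λ {χ} → agrees χ
    where
    agrees : ∀ χ → χ ∈ L → eval v (necessity x χ) ≡ eval (V y) (necessity x χ)
    agrees (□ A) m with V x (□ A)
    ... | true  = agree v y h (FL-closed φ m)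
    ... | false = refl
    agrees (var _)  _ = refl
    agrees ⊥'       _ = refl
    agrees (_ ⇒ _)  _ = refl
    agrees (□⁺ _)   _ = refl

  E : (W → Bool) → W → W → Bool
  E G x y = G y ∧ᵇ eval (V y) (unboxed x)

  reachable : (W → Bool) → W → W → Bool
  reachable G = Reachability.reach (E G)

  ⌜⌝⇒□⋁ : ∀ {G Y} x → Thm ⋁⌜ G ⌝ → (∀ {y} → E G x y ≡ true → Y y ≡ true) → Thm (⌜ x ⌝ ⇒ □ ⋁⌜ Y ⌝)
  ⌜⌝⇒□⋁ {G} {Y} x cover succ⊆Y = ⇒-trans (⌜⌝⇒□unboxed x) (□-mono (byTaut₁ lands cover))
    where
    lands : ∀ v → eval v ⋁⌜ G ⌝ ≡ true → eval v (unboxed x ⇒ ⋁⌜ Y ⌝) ≡ true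
    lands v c = ⇒-intro v (unboxed x) ⋁⌜ Y ⌝ λ u →
      let y , Gy , hy = ⋁-elim v G ⌜_⌝ c in
      ⋁-intro v Y ⌜_⌝ (succ⊆Y (∧ᵇ-intro Gy (trans (sym (unboxed-agree v x y hy)) u))) hy

  data Defect (G : W → Bool) (x : W) : Set where
    unfold-□       : □⁺ A ∈ L → V x (□⁺ A) ≡ true → V x (□ A) ≡ false → Defect G x
    unfold-□□⁺     : □⁺ A ∈ L → V x (□⁺ A) ≡ true → V x (□ (□⁺ A)) ≡ false → Defect G x
    □-unwitnessed  : □ A ∈ L → V x (□ A) ≡ false
                   → (∀ y → E G x y ≡ true → eval (V y) A ≡ true) → Defect G x
    □⁺-unwitnessed : □⁺ A ∈ L → V x (□⁺ A) ≡ false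
                   → (∀ y → reachable G x y ≡ true → eval (V y) A ≡ true) → Defect G x

  defect-refuted : ∀ {G x} → Thm ⋁⌜ G ⌝ → Defect G x → Thm (¬' ⌜ x ⌝)
  defect-refuted {x = x} _ (unfold-□ m e e′) =
    refute x (⇒-trans (⌜⌝⇒ x m e) □⁺⇒□) (proj₁ (proj₂ (FL-closed φ m))) e′
  defect-refuted {x = x} _ (unfold-□□⁺ m e e′) =
    refute x (⇒-trans (⌜⌝⇒ x m e) □⁺⇒□□⁺) (proj₂ (proj₂ (FL-closed φ m))) e′
  defect-refuted {G} {x} cover (□-unwitnessed m e none) =
    refute x (⇒-trans (⌜⌝⇒□⋁ x cover λ r → r) (□-mono (⋁⇒ (E G x) (FL-closed φ m) (none _)))) m e
  defect-refuted {G} {x} cover (□⁺-unwitnessed m e none) =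
    refute x (⇒-trans (□⁺-induction enter stay) (□⁺-mono (⋁⇒ Y (proj₁ (FL-closed φ m)) (none _)))) m e
    where
    open Reachability (E G) using (reach-base; reach-step)
    Y = reachable G x
    enter : Thm (⌜ x ⌝ ⇒ □ ⋁⌜ Y ⌝)
    enter = ⌜⌝⇒□⋁ x cover reach-base
    stay : Thm (⋁⌜ Y ⌝ ⇒ □ ⋁⌜ Y ⌝)
    stay = ⋁-⇒ Y ⌜_⌝ λ {y} Yy → ⌜⌝⇒□⋁ y cover (reach-step Yy)

  Fulfils : (W → Bool) → W → Fm → Set
  Fulfils G x (□ A)  = V x (□ A) ≡ false → ∃ λ y → E G x y ≡ true × eval (V y) A ≡ false
  Fulfils G x (□⁺ A) = (V x (□⁺ A) ≡ true → V x (□ A) ≡ true × V x (□ (□⁺ A)) ≡ true)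
                     × (V x (□⁺ A) ≡ false → ∃ λ y → reachable G x y ≡ true × eval (V y) A ≡ false)
  Fulfils G x _      = ⊤

  Saturated : (W → Bool) → W → Set
  Saturated G x = ∀ {χ} → χ ∈ L → Fulfils G x χ

  fulfils-or-defect : ∀ G x {χ} → χ ∈ L → Fulfils G x χ ⊎ Defect G x
  fulfils-or-defect G x {□ A} m with V x (□ A) in e
  ... | true  = inj₁ λ ()
  ... | false with search (λ y → ⇒ᵇ-or-counterexample (E G x y) (eval (V y) A))
  ...   | inj₁ none    = inj₂ (□-unwitnessed m e none)
  ...   | inj₂ witness = inj₁ λ _ → witness
  fulfils-or-defect G x {□⁺ A} m with V x (□⁺ A) in e
  ... | false with search (λ y → ⇒ᵇ-or-counterexample (reachable G x y) (eval (V y) A))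
  ...   | inj₁ none    = inj₂ (□⁺-unwitnessed m e none)
  ...   | inj₂ witness = inj₁ ((λ ()) , λ _ → witness)
  fulfils-or-defect G x {□⁺ A} m | true with V x (□ A) in e₁ | V x (□ (□⁺ A)) in e₂
  ...   | false | _     = inj₂ (unfold-□ m e e₁)
  ...   | true  | false = inj₂ (unfold-□□⁺ m e e₂)
  ...   | true  | true  = inj₁ ((λ _ → refl , refl) , λ ())
  fulfils-or-defect G x {var _}  _ = inj₁ tt
  fulfils-or-defect G x {⊥'}     _ = inj₁ tt
  fulfils-or-defect G x {_ ⇒ _}  _ = inj₁ tt

  saturated-or-defective : ∀ G x → (G x ≡ true → Saturated G x) ⊎ (G x ≡ true × Defect G x)
  saturated-or-defective G x with G x | ∈-search L (fulfils-or-defect G x)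
  ... | false | _      = inj₁ λ ()
  ... | true  | inj₁ s = inj₁ λ _ → s
  ... | true  | inj₂ d = inj₂ (refl , d)

  record SaturatedCover : Set₁ where
    field
      worlds    : W → Bool
      covers    : Thm ⋁⌜ worlds ⌝
      saturated : ∀ {x} → worlds x ≡ true → Saturated worlds x

  eliminate : ∀ n G → count G < n → Thm ⋁⌜ G ⌝ → SaturatedCover
  eliminate (suc n) G bound cover with search (saturated-or-defective G)
  ... | inj₁ saturated = record { worlds = G ; covers = cover ; saturated = saturated _ }
  ... | inj₂ (x , Gx , d) =
    eliminate n (G ─ x) (<-≤-trans (count-─ G Gx) (m<1+n⇒m≤n bound))
      (⋁-─ G ⌜_⌝ cover (defect-refuted cover d))

  saturatedCover : SaturatedCover
  saturatedCover = eliminate (suc (#World (length P))) everything (s≤s ≤-refl) ⋁⌜everything⌝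

  open SaturatedCover saturatedCover public
  open Kripke (E worlds) (λ x n → V x (var n)) public

  reach-worlds : ∀ {x y} → reach x y ≡ true → worlds y ≡ true
  reach-worlds = reach-ind (λ y → worlds y ≡ true) ∧ᵇ-elimˡ λ _ _ → ∧ᵇ-elimˡ

  truth : ∀ {x} → worlds x ≡ true → ∀ {χ} → χ ∈ L → sat x χ ≡ eval (V x) χ
  truth Gx {var n} m = refl
  truth Gx {⊥'}    m = refl
  truth Gx {A ⇒ B} m = let a , b = FL-closed φ m in cong₂ _⇒ᵇ_ (truth Gx a) (truth Gx b)
  truth {x} Gx {□ A} m with V x (□ A) in e
  ... | true  = □-intro A λ {y} r →
    trans (truth (∧ᵇ-elimˡ r) (FL-closed φ m)) (unboxed-elim (V y) x (∧ᵇ-elimʳ {worlds y} r) m e)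
  ... | false = let y , r , ¬A = saturated Gx m e in
    □-counter A r (trans (truth (∧ᵇ-elimˡ r) (FL-closed φ m)) ¬A)
  truth {x} Gx {□⁺ A} m with V x (□⁺ A) in e
  ... | true  = □⁺-intro A λ r →
    let Gy , _ , Ay = reach-ind Q (propagate Gx e) (λ _ (Gy , □⁺y , _) → propagate Gy □⁺y) r in
    trans (truth Gy A∈L) Ay
    where
    A∈L = proj₁ (FL-closed φ m)
    □A∈L = proj₁ (proj₂ (FL-closed φ m))
    □□⁺A∈L = proj₂ (proj₂ (FL-closed φ m))
    Q : W → Set
    Q y = worlds y ≡ true × V y (□⁺ A) ≡ true × eval (V y) A ≡ true
    propagate : ∀ {y z} → worlds y ≡ true → V y (□⁺ A) ≡ true → E worlds y z ≡ true → Q z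
    propagate {y} {z} Gy □⁺y r =
      let □y , □□⁺y = proj₁ (saturated Gy m) □⁺y
          u = ∧ᵇ-elimʳ {worlds z} r in
      ∧ᵇ-elimˡ r , unboxed-elim (V z) y u □□⁺A∈L □□⁺y , unboxed-elim (V z) y u □A∈L □y
  ... | false = let y , r , ¬A = proj₂ (saturated Gx m) e in
    □⁺-counter A r (trans (truth (reach-worlds r) (proj₁ (FL-closed φ m))) ¬A)

  complete : (∀ {x} → worlds x ≡ true → sat x φ ≡ true) → Thm φ
  complete valid = mp covers (⋁-⇒ worlds ⌜_⌝ λ {x} Gx →
    ⌜⌝⇒ x (FL-self φ) (trans (sym (truth Gx (FL-self φ))) (valid Gx)))

-- Admissibility of (ω)

ω-admissible : (Σ : List Fm) (C : Fm) (B : ℕ → Fm)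
             → Der false (_∈ Σ) Γ (B 0 ⇒ □ (C ∧' B 1))
             → (∀ n → Der false (_∈ Σ) (_∈ Σ) (B (suc n) ⇒ □ (C ∧' B (suc (suc n)))))
             → Der false (_∈ Σ) Γ (B 0 ⇒ □⁺ C)
ω-admissible Σ C B first next = mp first (mp (nec (⋀-hyp Σ λ m → m)) (complete valid))
  where
  φ : Fm
  φ = □⁺ (⋀ Σ) ⇒ (B 0 ⇒ □ (C ∧' B 1)) ⇒ B 0 ⇒ □⁺ C
  open Filtration φ

  valid : ∀ {x} → worlds x ≡ true → sat x φ ≡ true
  valid {x} _ =
    sat-⇒-intro x (□⁺ (⋀ Σ)) ((B 0 ⇒ □ (C ∧' B 1)) ⇒ B 0 ⇒ □⁺ C) λ □⁺Σ →
    sat-⇒-intro x (B 0 ⇒ □ (C ∧' B 1)) (B 0 ⇒ □⁺ C) λ first′ →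
    ω-sound C B first′ λ n r →
      sound (next n) (λ y → reach x y ≡ true) (reach-step {x}) (Σ-holds □⁺Σ)
            (reach-step {x} r) (Σ-holds □⁺Σ r)
    where
    Σ-holds : sat x (□⁺ (⋀ Σ)) ≡ true → ∀ {y} → reach x y ≡ true → ∀ {A} → A ∈ Σ → sat y A ≡ true
    Σ-holds □⁺Σ {y} r {A} m =
      let ⋀Σ = trans (sat-eval y (⋀ Σ)) (□⁺-elim {x} {y} (⋀ Σ) □⁺Σ r) in
      trans (sym (sat-eval y A)) (⋀-elim (sat y) Σ ⋀Σ m)

ω-elimination : {Σ : List Fm} → Der true (_∈ Σ) Γ A → Der false (_∈ Σ) Γ A
ω-elimination (ax a)               = ax a
ω-elimination (hyp h)              = hyp h
ω-elimination (mp d e)             = mp (ω-elimination d) (ω-elimination e)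
ω-elimination (nec d)              = nec (ω-elimination d)
ω-elimination {Σ = Σ} (omega _ C B d ds) =
  ω-admissible Σ C B (ω-elimination d) (ω-elimination ∘ ds)

proposition28 : (Σ : List Fm) (Γ : Fm → Set) (A : Fm) → Σ ⨾ Γ ⊢ω A → Σ ⨾ Γ ⊢ A
proposition28 Σ Γ A = ω-elimination
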